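{- Let $a$ be a positive integer. There is no integer solution $(x_1,x_2,x_3)$ to the equation $ax_1+ax_2=(a+1)x_3$ satisfying any one of the following conditions: \begin{enumerate} \item[(a)] $x_1,x_2,x_3\not\equiv 0 \pmod{a}$; \item[(b)] $x_1,x_2,x_3\equiv 0\pmod{a}$ and $x_1,x_2,x_3\not\equiv 0\pmod{a^2}$; \item[(c)] $x_1,x_2\equiv 0\pmod{a^2}$ and $x_3\not\equiv 0\pmod{a}$; \item[(d)] $x_1,x_3\equiv 0\pmod{a^2}$ and $x_2\not\equiv 0\pmod{a}$; \item[(e)] $x_2,x_3\equiv 0\pmod{a^2}$ and $x_1\not\equiv 0\pmod{a}$; \item[(f)] $x_1\equiv 0\pmod{a^2}$ and $x_2,x_3\not\equiv 0\pmod{a}$; \item[(g)] $x_2\equiv 0\pmod{a^2}$ and $x_1,x_3\not\equiv 0\pmod{a}$. \end{enumerate}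
   Context: A condition such as "$x_1,x_2,x_3\not\equiv 0\pmod a$" means each of the listed integers individually is not divisible by $a$ (and similarly for the other conditions). -}

module Defs where

open import Data.Nat using (ℕ)
open import Data.Integer using (ℤ; +_; _*_)
open import Data.Integer.Divisibility using (_∣_)
open import Data.Product using (_×_)
open import Data.Sum using (_⊎_)
open import Relation.Nullary using (¬_)

_≡0mod_ : ℤ → ℤ → Set
x ≡0mod m = m ∣ x

_≢0mod_ : ℤ → ℤ → Set
x ≢0mod m = ¬ (m ∣ x)

module _ (a : ℕ) (x₁ x₂ x₃ : ℤ) where
  private
    A  = + a
    A² = + a * + a

  condA condB condC condD condE condF condG : Set
  condA = x₁ ≢0mod A × x₂ ≢0mod A × x₃ ≢0mod A
  condB = (x₁ ≡0mod A × x₂ ≡0mod A × x₃ ≡0mod A)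
        × (x₁ ≢0mod A² × x₂ ≢0mod A² × x₃ ≢0mod A²)
  condC = (x₁ ≡0mod A² × x₂ ≡0mod A²) × x₃ ≢0mod A
  condD = (x₁ ≡0mod A² × x₃ ≡0mod A²) × x₂ ≢0mod A
  condE = (x₂ ≡0mod A² × x₃ ≡0mod A²) × x₁ ≢0mod A
  condF = x₁ ≡0mod A² × (x₂ ≢0mod A × x₃ ≢0mod A)
  condG = x₂ ≡0mod A² × (x₁ ≢0mod A × x₃ ≢0mod A)

  anyCond : Set
  anyCond = condA ⊎ condB ⊎ condC ⊎ condD ⊎ condE ⊎ condF ⊎ condG

{-# OPTIONS --safe #-}
module Submission where

-- For k x + k y = (k + 1) z, subtracting k z from both sides gives z = k (x + y − z), so k ∣ z
-- always, and k² ∣ z once k divides x and y. If k² ∣ z then k² divides k x + k y = (k + 1) z,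
-- so, cancelling k ≠ 0, k divides x exactly when it divides y. Each of the conditions (a)–(g)
-- contradicts one of these three facts for k = a.

open import Defs
open import Data.Nat using (ℕ; _<_; >-nonZero)
open import Data.Integer using (ℤ; +_; _*_; _+_; _-_; 1ℤ; NonZero)
open import Relation.Binary.PropositionalEquality using (_≡_; sym; cong; subst; module ≡-Reasoning)
open import Relation.Nullary using (¬_)

import Data.Integer.Divisibility as Unsigned
open import Data.Integer.Divisibility.Signed
  using (_∣_; ∣ᵤ⇒∣; ∣⇒∣ᵤ; divides; ∣-refl; ∣-trans; ∣m∣n⇒∣m+n; ∣m∣n⇒∣m-n; ∣m+n∣m⇒∣n; ∣m+n∣n⇒∣m;
         ∣m⇒∣m*n; ∣n⇒∣m*n; *-monoʳ-∣; *-cancelˡ-∣)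
open import Data.Integer.Properties using (*-comm)
open import Data.Integer.Tactic.RingSolver using (solve)
open import Data.List using (_∷_; [])
open import Data.Product using (_,_)
open import Data.Sum using (inj₁; inj₂)

m*n∣o⇒m∣o : ∀ {m} n {o} → m * n ∣ o → m ∣ o
m*n∣o⇒m∣o n m*n∣o = ∣-trans (∣m⇒∣m*n n ∣-refl) m*n∣o

module Solution {k x y z : ℤ} (eq : k * x + k * y ≡ (k + 1ℤ) * z) where

  z≡k*[x+y-z] : z ≡ k * (x + y - z)
  z≡k*[x+y-z] = begin
    z                     ≡⟨ solve (k ∷ z ∷ []) ⟩
    (k + 1ℤ) * z - k * z  ≡⟨ cong (_- k * z) (sym eq) ⟩
    k * x + k * y - k * z ≡⟨ solve (k ∷ x ∷ y ∷ z ∷ []) ⟩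
    k * (x + y - z)       ∎
    where open ≡-Reasoning

  k∣z : k ∣ z
  k∣z = divides (x + y - z) (subst (z ≡_) (*-comm k (x + y - z)) z≡k*[x+y-z])

  k*k∣z : k ∣ x → k ∣ y → k * k ∣ z
  k*k∣z k∣x k∣y = subst (k * k ∣_) (sym z≡k*[x+y-z]) (*-monoʳ-∣ k (∣m∣n⇒∣m-n (∣m∣n⇒∣m+n k∣x k∣y) k∣z))

  module _ .{{_ : NonZero k}} (k*k∣z : k * k ∣ z) where

    k*k∣k*x+k*y : k * k ∣ k * x + k * y
    k*k∣k*x+k*y = subst (k * k ∣_) (sym eq) (∣n⇒∣m*n (k + 1ℤ) k*k∣z)

    k∣y : k ∣ x → k ∣ y
    k∣y k∣x = *-cancelˡ-∣ k (∣m+n∣m⇒∣n k*k∣k*x+k*y (*-monoʳ-∣ k k∣x))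

    k∣x : k ∣ y → k ∣ x
    k∣x k∣y = *-cancelˡ-∣ k (∣m+n∣n⇒∣m k*k∣k*x+k*y (*-monoʳ-∣ k k∣y))

lemma2 : (a : ℕ) → 0 < a → (x₁ x₂ x₃ : ℤ) →
    + a * x₁ + + a * x₂ ≡ (+ a + + 1) * x₃ → ¬ anyCond a x₁ x₂ x₃
lemma2 a 0<a x₁ x₂ x₃ eq = λ
  { (inj₁ (_ , _ , a∤x₃))                                      → a∤x₃ (∣⇒∣ᵤ k∣z)
  ; (inj₂ (inj₁ ((a∣x₁ , a∣x₂ , _) , _ , _ , a²∤x₃)))           → a²∤x₃ (∣⇒∣ᵤ (k*k∣z (∣ᵤ⇒∣ a∣x₁) (∣ᵤ⇒∣ a∣x₂)))
  ; (inj₂ (inj₂ (inj₁ (_ , a∤x₃))))                             → a∤x₃ (∣⇒∣ᵤ k∣z)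
  ; (inj₂ (inj₂ (inj₂ (inj₁ ((a²∣x₁ , a²∣x₃) , a∤x₂)))))        → a∤x₂ (∣⇒∣ᵤ (k∣y (∣ᵤ⇒∣ a²∣x₃) (a²∣⇒a∣ x₁ a²∣x₁)))
  ; (inj₂ (inj₂ (inj₂ (inj₂ (inj₁ ((a²∣x₂ , a²∣x₃) , a∤x₁)))))) → a∤x₁ (∣⇒∣ᵤ (k∣x (∣ᵤ⇒∣ a²∣x₃) (a²∣⇒a∣ x₂ a²∣x₂)))
  ; (inj₂ (inj₂ (inj₂ (inj₂ (inj₂ (inj₁ (_ , _ , a∤x₃)))))))    → a∤x₃ (∣⇒∣ᵤ k∣z)
  ; (inj₂ (inj₂ (inj₂ (inj₂ (inj₂ (inj₂ (_ , _ , a∤x₃)))))))    → a∤x₃ (∣⇒∣ᵤ k∣z)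
  }
  where
  instance
    a≢0 : NonZero (+ a)
    a≢0 = >-nonZero 0<a
  -- Unsigned divisibility only constrains absolute values, so Agda cannot infer the integers.
  open Solution {+ a} {x₁} {x₂} {x₃} eq
  a²∣⇒a∣ : ∀ x → + a * + a Unsigned.∣ x → + a ∣ x
  a²∣⇒a∣ x a²∣x = m*n∣o⇒m∣o (+ a) (∣ᵤ⇒∣ {+ a * + a} {x} a²∣x)
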